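{- The inner univalent multirelations form a category whose objects are sets, whose arrows from $X$ to $Y$ are the inner univalent multirelations $X \leftrightarrow \mathcal{P} Y$, whose composition is Peleg composition $\ast$ and whose identity arrows are the $1_X$.
   Context: A multirelation $R : X \leftrightarrow \mathcal{P} Y$ is a subset of $X \times \mathcal{P} Y$. $R$ is inner univalent if every $B$ with $(a,B) \in R$ is either empty or a singleton set. $1_X = \{(a,\{a\}) \mid a \in X\}$. The Peleg composition of $R : X \leftrightarrow \mathcal{P} Y$ and $S : Y \leftrightarrow \mathcal{P} Z$ is $R \ast S = \{(a,C) \mid \exists B.\ (a,B) \in R \wedge \exists f : Y \to \mathcal{P} Z.\ (\forall b \in B.\ (b,f(b)) \in S) \wedge C = \bigcup_{b \in B} f(b)\}$. -}

module Defs where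

open import Level using (Level; Lift; _⊔_) renaming (suc to lsuc; zero to lzero)
open import Data.Product using (Σ; _×_; _,_; proj₁)
open import Data.Sum using (_⊎_)
open import Data.Empty using (⊥)
open import Relation.Nullary using (¬_)
open import Relation.Binary.PropositionalEquality using (_≡_)
open import Relation.Binary.Core using (Rel)
open import Relation.Binary.Structures using (IsEquivalence)

𝒫 : Set → Set₁
𝒫 Y = Y → Set

_≐_ : {Y : Set} → 𝒫 Y → 𝒫 Y → Set
_≐_ {Y} B C = ∀ y → (B y → C y) × (C y → B y)

-- Multirelations R : X ↔ 𝒫 Y, i.e. subsets of X × 𝒫 Y.
Mult : Set → Set → Set₂
Mult X Y = X → 𝒫 Y → Set₁

-- Equality of multirelations as sets of pairs (a , B): pairs are equal when
-- a agrees and the subsets B are extensionally equal.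
_≈ᴹ_ : {X Y : Set} → Mult X Y → Mult X Y → Set₁
_≈ᴹ_ {X} {Y} R S =
  (∀ a B → R a B → Σ (𝒫 Y) λ B' → S a B' × (B ≐ B')) ×
  (∀ a B → S a B → Σ (𝒫 Y) λ B' → R a B' × (B ≐ B'))

InnerUnivalent : {X Y : Set} → Mult X Y → Set₁
InnerUnivalent {X} {Y} R =
  ∀ a B → R a B → (∀ y → ¬ B y) ⊎ (Σ Y λ b → B ≐ (λ y → y ≡ b))

one : (X : Set) → Mult X X
one X a B = Lift (lsuc lzero) (B ≐ (λ y → y ≡ a))

_✱_ : {X Y Z : Set} → Mult X Y → Mult Y Z → Mult X Z
_✱_ {X} {Y} {Z} R S a C =
  Σ (𝒫 Y) λ B → R a B ×
  (Σ (Y → 𝒫 Z) λ f → (∀ b → B b → S b (f b)) ×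
     (C ≐ (λ z → Σ Y λ b → B b × f b z)))

IUHom : Set → Set → Set₂
IUHom X Y = Σ (Mult X Y) InnerUnivalent

_≈_ : {X Y : Set} → Rel (IUHom X Y) (lsuc lzero)
R ≈ S = proj₁ R ≈ᴹ proj₁ S

record IsCategory {o h e : Level} (Ob : Set o) (Hom : Ob → Ob → Set h)
    (_≃_ : ∀ {A B} → Rel (Hom A B) e)
    (id : ∀ {A} → Hom A A)
    (_⨾_ : ∀ {A B C} → Hom A B → Hom B C → Hom A C) : Set (o ⊔ h ⊔ e) where
  field
    isEquivalence : ∀ {A B} → IsEquivalence (_≃_ {A} {B})
    assoc : ∀ {A B C D} (f : Hom A B) (g : Hom B C) (k : Hom C D) →
            ((f ⨾ g) ⨾ k) ≃ (f ⨾ (g ⨾ k))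
    identityˡ : ∀ {A B} (f : Hom A B) → (id ⨾ f) ≃ f
    identityʳ : ∀ {A B} (f : Hom A B) → (f ⨾ id) ≃ f
    ⨾-resp-≃ : ∀ {A B C} {f f' : Hom A B} {g g' : Hom B C} →
               f ≃ f' → g ≃ g' → (f ⨾ g) ≃ (f' ⨾ g')

{-# OPTIONS --safe #-}
module Submission where

-- If every set R reaches is empty or a singleton, then (a , C) ∈ R ✱ S means
-- either that R reaches an empty set from a and C = ∅, or that R reaches some
-- {b} from a and (b , C) ∈ S: composing after such an R never forms genuine
-- unions.  Closure under composition, compatibility with ≈ᴹ and the reverse
-- half of associativity reduce to this case distinction; the remaining
-- category laws are laws of indexed unions and hold for all multirelations.

open import Defs
open import Data.Product using (Σ; _×_; _,_; proj₁; proj₂)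
open import Data.Sum using (inj₁; inj₂)
open import Data.Empty using (⊥-elim)
open import Level using (lift; lower)
open import Relation.Binary.PropositionalEquality using (_≡_; refl; sym; subst)
open import Relation.Binary.Structures using (IsEquivalence)
open import Relation.Unary using (Empty; ∅)

private
  variable
    X Y Z W : Set

-- Oriented as in Defs (y ≡ b), unlike Relation.Unary.｛_｝.
｛_｝ : Y → 𝒫 Y
｛ b ｝ = λ y → y ≡ b

⋃ : 𝒫 Y → (Y → 𝒫 Z) → 𝒫 Z
⋃ {Y} B f z = Σ Y λ b → B b × f b z

≐-refl : {B : 𝒫 Y} → B ≐ B
≐-refl y = (λ x → x) , (λ x → x)

≐-sym : {B C : 𝒫 Y} → B ≐ C → C ≐ B
≐-sym e y = proj₂ (e y) , proj₁ (e y)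

≐-trans : {B C D : 𝒫 Y} → B ≐ C → C ≐ D → B ≐ D
≐-trans e e' y = (λ x → proj₁ (e' y) (proj₁ (e y) x)) , (λ x → proj₂ (e y) (proj₂ (e' y) x))

Empty-resp-≐ : {B C : 𝒫 Y} → B ≐ C → Empty B → Empty C
Empty-resp-≐ e emp y c = emp y (proj₂ (e y) c)

Empty⇒≐∅ : {B : 𝒫 Y} → Empty B → B ≐ ∅
Empty⇒≐∅ emp y = (λ b → emp y b) , (λ ())

⋃-Empty : {B : 𝒫 Y} (f : Y → 𝒫 Z) → Empty B → Empty (⋃ B f)
⋃-Empty f emp z (b , Bb , _) = emp b Bb

⋃-singleton : {B : 𝒫 Y} {b : Y} (f : Y → 𝒫 Z) → B ≐ ｛ b ｝ → ⋃ B f ≐ f b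
⋃-singleton {B = B} {b} f e z = collapse , (λ fbz → b , proj₂ (e b) refl , fbz)
  where
  collapse : ⋃ B f z → f b z
  collapse (b' , Bb' , fb'z) with proj₁ (e b') Bb'
  ... | refl = fb'z

⋃-singletons : {B : 𝒫 Y} (f : Y → 𝒫 Y) → (∀ b → B b → f b ≐ ｛ b ｝) → ⋃ B f ≐ B
⋃-singletons {B = B} f e y = collapse , (λ By → y , By , proj₂ (e y By y) refl)
  where
  collapse : ⋃ B f y → B y
  collapse (b , Bb , fby) with proj₁ (e b Bb y) fby
  ... | refl = Bb

⋃-assoc : (B : 𝒫 Y) (f : Y → 𝒫 Z) (g : Z → 𝒫 W) →
          ⋃ (⋃ B f) g ≐ ⋃ B (λ b → ⋃ (f b) g)
⋃-assoc B f g w =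
  (λ { (c , (b , Bb , fbc) , gcw) → b , Bb , c , fbc , gcw }) ,
  (λ { (b , Bb , c , fbc , gcw) → c , (b , Bb , fbc) , gcw })

⋃-cong-index : {B B' : 𝒫 Y} (f : Y → 𝒫 Z) → B ≐ B' → ⋃ B f ≐ ⋃ B' f
⋃-cong-index f e z =
  (λ { (b , Bb , fbz) → b , proj₁ (e b) Bb , fbz }) ,
  (λ { (b , B'b , fbz) → b , proj₂ (e b) B'b , fbz })

_⊆ᴹ_ : Mult X Y → Mult X Y → Set₁
_⊆ᴹ_ {X} {Y} R S = ∀ a B → R a B → Σ (𝒫 Y) λ B' → S a B' × (B ≐ B')

⊆ᴹ-refl : {R : Mult X Y} → R ⊆ᴹ R
⊆ᴹ-refl a B r = B , r , ≐-refl

⊆ᴹ-trans : {R S T : Mult X Y} → R ⊆ᴹ S → S ⊆ᴹ T → R ⊆ᴹ T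
⊆ᴹ-trans R⊆S S⊆T a B r with R⊆S a B r
... | B' , s , e with S⊆T a B' s
...   | B'' , t , e' = B'' , t , ≐-trans e e'

⊆ᴹ-from-members : {R S : Mult X Y} → (∀ a B → R a B → S a B) → R ⊆ᴹ S
⊆ᴹ-from-members R⊂S a B r = B , R⊂S a B r , ≐-refl

≈-isEquivalence : IsEquivalence (_≈_ {X} {Y})
≈-isEquivalence = record
  { refl  = ⊆ᴹ-refl , ⊆ᴹ-refl
  ; sym   = λ (R⊆S , S⊆R) → S⊆R , R⊆S
  ; trans = λ (R⊆S , S⊆R) (S⊆T , T⊆S) → ⊆ᴹ-trans R⊆S S⊆T , ⊆ᴹ-trans T⊆S S⊆R
  }

module _ (R : Mult X Y) (S : Mult Y Z) {a : X} where

  ✱-intro-∅ : ∀ {B} → R a B → Empty B → (R ✱ S) a ∅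
  ✱-intro-∅ {B} r emp =
    B , r , (λ _ → ∅) , (λ b Bb → ⊥-elim (emp b Bb)) ,
    ≐-sym (Empty⇒≐∅ (⋃-Empty (λ _ → ∅) emp))

  ✱-intro-｛｝ : ∀ {B b C} → R a B → B ≐ ｛ b ｝ → S b C → (R ✱ S) a C
  ✱-intro-｛｝ {B} {b} {C} r e s =
    B , r , (λ _ → C) , (λ b' Bb' → subst (λ y → S y C) (sym (proj₁ (e b') Bb')) s) ,
    ≐-sym (⋃-singleton (λ _ → C) e)

  data ✱-View (C : 𝒫 Z) : Set₁ where
    via-∅ : ∀ {B} → R a B → Empty B → Empty C → ✱-View C
    via-｛｝ : ∀ {B b C'} → R a B → B ≐ ｛ b ｝ → S b C' → C ≐ C' → ✱-View C

  ✱-view : InnerUnivalent R → ∀ {C} → (R ✱ S) a C → ✱-View C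
  ✱-view iuR (B , r , f , s , e) with iuR a B r
  ... | inj₁ emp = via-∅ r emp (Empty-resp-≐ (≐-sym e) (⋃-Empty f emp))
  ... | inj₂ (b , eb) = via-｛｝ r eb (s b (proj₂ (eb b) refl)) (≐-trans e (⋃-singleton f eb))

one-innerUnivalent : ∀ X → InnerUnivalent (one X)
one-innerUnivalent X a B (lift e) = inj₂ (a , e)

✱-innerUnivalent : (R : Mult X Y) (S : Mult Y Z) →
                   InnerUnivalent R → InnerUnivalent S → InnerUnivalent (R ✱ S)
✱-innerUnivalent R S iuR iuS a C rs with ✱-view R S iuR rs
... | via-∅ _ _ emp = inj₁ emp
... | via-｛｝ {b = b} {C'} _ _ s e with iuS b C' s
...   | inj₁ emp = inj₁ (Empty-resp-≐ (≐-sym e) emp)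
...   | inj₂ (c , ec) = inj₂ (c , ≐-trans e ec)

✱-mono : {R R' : Mult X Y} {S S' : Mult Y Z} → InnerUnivalent R →
         R ⊆ᴹ R' → S ⊆ᴹ S' → (R ✱ S) ⊆ᴹ (R' ✱ S')
✱-mono {R = R} {R'} {S} {S'} iuR R⊆R' S⊆S' a C rs with ✱-view R S iuR rs
... | via-∅ {B} r empB empC with R⊆R' a B r
...   | _ , r' , e = ∅ , ✱-intro-∅ R' S' r' (Empty-resp-≐ e empB) , Empty⇒≐∅ empC
✱-mono {R = R} {R'} {S} {S'} iuR R⊆R' S⊆S' a C rs | via-｛｝ {B} {b} {C'} r eb s e
  with R⊆R' a B r | S⊆S' b C' s
... | _ , r' , eB | C'' , s' , eC = C'' , ✱-intro-｛｝ R' S' r' (≐-trans (≐-sym eB) eb) s' , ≐-trans e eC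

✱-resp-≈ᴹ : {R R' : Mult X Y} {S S' : Mult Y Z} → InnerUnivalent R → InnerUnivalent R' →
            R ≈ᴹ R' → S ≈ᴹ S' → (R ✱ S) ≈ᴹ (R' ✱ S')
✱-resp-≈ᴹ iuR iuR' (R⊆R' , R'⊆R) (S⊆S' , S'⊆S) =
  ✱-mono iuR R⊆R' S⊆S' , ✱-mono iuR' R'⊆R S'⊆S

✱-assoc-⊆ : (R : Mult X Y) (S : Mult Y Z) (T : Mult Z W) →
            ((R ✱ S) ✱ T) ⊆ᴹ (R ✱ (S ✱ T))
✱-assoc-⊆ R S T = ⊆ᴹ-from-members λ
  { a E (C , (B , r , f , s , eC) , g , t , eE) →
      B , r , (λ b → ⋃ (f b) g) ,
      (λ b Bb → f b , s b Bb , g , (λ c fbc → t c (proj₂ (eC c) (b , Bb , fbc))) , ≐-refl) ,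
      ≐-trans eE (≐-trans (⋃-cong-index g eC) (⋃-assoc B f g)) }

✱-assoc-⊇ : (R : Mult X Y) (S : Mult Y Z) (T : Mult Z W) → InnerUnivalent R →
            (R ✱ (S ✱ T)) ⊆ᴹ ((R ✱ S) ✱ T)
✱-assoc-⊇ R S T iuR a E rst with ✱-view R (S ✱ T) iuR rst
... | via-∅ r empB empE =
  ∅ , ✱-intro-∅ (R ✱ S) T (✱-intro-∅ R S r empB) (λ _ ()) , Empty⇒≐∅ empE
... | via-｛｝ r eb (C , s , g , t , eE') eE =
  _ , (C , ✱-intro-｛｝ R S r eb s , g , t , eE') , eE

one-✱ : (R : Mult X Y) → (one X ✱ R) ≈ᴹ R
one-✱ {X} R =
  (λ { a C (B , lift e , f , r , eC) → f a , r a (proj₂ (e a) refl) , ≐-trans eC (⋃-singleton f e) }) ,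
  ⊆ᴹ-from-members (λ a C r → ✱-intro-｛｝ (one X) R (lift ≐-refl) ≐-refl r)

✱-one : (R : Mult X Y) → (R ✱ one Y) ≈ᴹ R
✱-one R =
  (λ { a C (B , r , f , ones , eC) →
         B , r , ≐-trans eC (⋃-singletons f (λ b Bb → lower (ones b Bb))) }) ,
  ⊆ᴹ-from-members (λ a C r →
    C , r , ｛_｝ , (λ _ _ → lift ≐-refl) , ≐-sym (⋃-singletons ｛_｝ (λ _ _ → ≐-refl)))

proposition4p5 :
    Σ (∀ X → InnerUnivalent (one X)) λ oneIU →
    Σ (∀ {X Y Z} (R : Mult X Y) (S : Mult Y Z) →
         InnerUnivalent R → InnerUnivalent S → InnerUnivalent (R ✱ S)) λ compIU →
    IsCategory Set IUHom _≈_
      (λ {X} → one X , oneIU X)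
      (λ R S → (proj₁ R ✱ proj₁ S) , compIU (proj₁ R) (proj₁ S) (Σ.proj₂ R) (Σ.proj₂ S))
proposition4p5 = one-innerUnivalent , ✱-innerUnivalent , record
  { isEquivalence = ≈-isEquivalence
  ; assoc         = λ (R , iuR) (S , _) (T , _) → ✱-assoc-⊆ R S T , ✱-assoc-⊇ R S T iuR
  ; identityˡ     = λ (R , _) → one-✱ R
  ; identityʳ     = λ (R , _) → ✱-one R
  ; ⨾-resp-≃      = λ {_} {_} {_} {R} {R'} → ✱-resp-≈ᴹ (proj₂ R) (proj₂ R')
  }
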